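{- For two brooms $T_1,T_2$ on a complete split graph $G$, the function $f$ attains its minimum over $\{0,1\}^Y$ at some point $x$ such that $x_u\leq x_v$ for every $u\in Y$ and every $v\in F_u$.
   Context: A complete split graph $G$ has vertex set partitioned into $P$ ($|P|=p\ge 1$) inducing a clique and $Q$ ($|Q|=q$) inducing an independent set, with every vertex of $P$ adjacent to every vertex of $Q$. A broom on $G$ consists of a handle, a sequence of vertices listed from top (root) to bottom whose elements are exactly $P\cup S$ for some $S\subseteq Q$, with bottommost element in $P$, together with the set $Q\setminus S$ of leaves; $u$ is above $v$ if it comes earlier in the handle. Notation for the fixed brooms $T_1,T_2$: $Y$ is the set of vertices of $Q$ lying in the handles of both $T_1$ and $T_2$; points of $\{0,1\}^Y$ have coordinates $x_u$, $u\in Y$. $\sigma$ is the permutation of $\{1,\dots,p\}$ obtained by labeling the vertices of $P$ from $1$ to $p$ in their top-to-bottom order in the handle of $T_1$ and reading these labels top to bottom in the handle of $T_2$; $\mathrm{inv}(\sigma)$ is its number of inversions. For $u\in Q\setminus Y$: if $u$ lies in the handle of one of $T_1,T_2$, $A_u$ is the set of vertices of $P$ below $u$ in that handle; otherwise $A_u=\emptyset$. For $u\in Y$: $B_u$ is the set of vertices of $P$ above $u$ in one of $T_1,T_2$ and below $u$ in the other; $C_u$ is the set of vertices of $P$ below $u$ in both; $D_u$ is the set of vertices of $Q\setminus Y$ above $u$ in the handle of $T_1$ or of $T_2$; $E_u$ is the set of vertices of $Y$ above $u$ in one of $T_1,T_2$ and below $u$ in the other; $F_u$ is the set of vertices of $Y$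 below $u$ in both. The function $f:\{0,1\}^Y\to\mathbb{N}$ is $$f(x)=\mathrm{inv}(\sigma)+\sum_{u\in Q\setminus Y}|A_u|+\sum_{u\in Y}\bigl(|B_u|+2|C_u|x_u+|D_u|(1-x_u)\bigr)+\frac12\sum_{u\in Y}\sum_{v\in E_u}(1+x_u)(1-x_v)+2\sum_{u\in Y}\sum_{v\in F_u}x_u(1-x_v).$$ -}

module Defs where

open import Data.Nat using (ℕ; zero; suc; _+_; _*_; _∸_; _≤_; _/_)
open import Data.Bool using (Bool; true; false; T; _∧_; _∨_; not; if_then_else_)
open import Data.Fin using (Fin; zero; suc)
import Data.Fin.Properties as FinP
open import Data.Sum using (_⊎_; inj₁; inj₂)
open import Data.Sum.Properties using (≡-dec)
open import Data.List using (List; []; _∷_; _∷ʳ_; map; allFin)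
open import Data.Nat.ListAction using (sum)
open import Data.List.Relation.Unary.Unique.Propositional using (Unique)
open import Data.List.Membership.Propositional using (_∈_)
open import Data.Product using (∃₂; Σ; _,_)
open import Relation.Binary.PropositionalEquality using (_≡_)
open import Relation.Nullary.Decidable using (⌊_⌋; Dec)
open import Data.Unit using (tt)

-- Vertices of the complete split graph: P = Fin p (clique), Q = Fin q (independent set).
V : ℕ → ℕ → Set
V p q = Fin p ⊎ Fin q

_≟V_ : ∀ {p q} (a b : V p q) → Dec (a ≡ b)
_≟V_ = ≡-dec FinP._≟_ FinP._≟_

-- A broom: the handle is a duplicate-free list of vertices, listed top (root)
-- to bottom, containing every vertex of P, whose last (bottommost) element is in P.
-- The vertices of Q in the handle form S; the leaves are the vertices of Q not in it.
record Broom (p q : ℕ) : Set where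
  field
    handle  : List (V p q)
    unique  : Unique handle
    coversP : (a : Fin p) → inj₁ a ∈ handle
    bottomP : ∃₂ λ (xs : List (V p q)) (a : Fin p) → handle ≡ xs ∷ʳ inj₁ a
open Broom public

memᵇ : ∀ {p q} → List (V p q) → V p q → Bool
memᵇ [] b = false
memᵇ (c ∷ L) b = if ⌊ c ≟V b ⌋ then true else memᵇ L b

aboveᵇ : ∀ {p q} → List (V p q) → V p q → V p q → Bool
aboveᵇ [] a b = false
aboveᵇ (c ∷ L) a b =
  if ⌊ c ≟V a ⌋ then memᵇ L b else (if ⌊ c ≟V b ⌋ then false else aboveᵇ L a b)

above : ∀ {p q} → Broom p q → V p q → V p q → Bool
above T = aboveᵇ (handle T)

inHandle : ∀ {p q} → Broom p q → V p q → Bool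
inHandle T = memᵇ (handle T)

sumF : (n : ℕ) → (Fin n → ℕ) → ℕ
sumF n g = sum (map g (allFin n))

bit : Bool → ℕ
bit true = 1
bit false = 0

count : (n : ℕ) → (Fin n → Bool) → ℕ
count n g = sumF n (λ i → bit (g i))

module _ {p q : ℕ} (T₁ T₂ : Broom p q) where

  inY : Fin q → Bool
  inY u = inHandle T₁ (inj₂ u) ∧ inHandle T₂ (inj₂ u)

  Pt : Set
  Pt = (u : Fin q) → T (inY u) → Bool

  coord : Pt → Fin q → ℕ
  coord x u = aux (inY u) (x u)
    where
      aux : (b : Bool) → (T b → Bool) → ℕ
      aux true g = bit (g tt)
      aux false g = 0

  sumY : (Fin q → ℕ) → ℕ
  sumY g = sumF q (λ u → if inY u then g u else 0)

  invσ : ℕ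
  invσ = sumF p (λ a → count p (λ b →
           above T₁ (inj₁ a) (inj₁ b) ∧ above T₂ (inj₁ b) (inj₁ a)))

  cardA : Fin q → ℕ
  cardA u = if inHandle T₁ (inj₂ u)
              then count p (λ a → above T₁ (inj₂ u) (inj₁ a))
              else (if inHandle T₂ (inj₂ u)
                      then count p (λ a → above T₂ (inj₂ u) (inj₁ a))
                      else 0)

  cardB : Fin q → ℕ
  cardB u = count p (λ a →
    (above T₁ (inj₁ a) (inj₂ u) ∧ above T₂ (inj₂ u) (inj₁ a)) ∨
    (above T₂ (inj₁ a) (inj₂ u) ∧ above T₁ (inj₂ u) (inj₁ a)))

  cardC : Fin q → ℕ
  cardC u = count p (λ a → above T₁ (inj₂ u) (inj₁ a) ∧ above T₂ (inj₂ u) (inj₁ a))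

  cardD : Fin q → ℕ
  cardD u = count q (λ v → not (inY v) ∧
    (above T₁ (inj₂ v) (inj₂ u) ∨ above T₂ (inj₂ v) (inj₂ u)))

  inE : Fin q → Fin q → Bool
  inE u v = inY v ∧
    ((above T₁ (inj₂ v) (inj₂ u) ∧ above T₂ (inj₂ u) (inj₂ v)) ∨
     (above T₂ (inj₂ v) (inj₂ u) ∧ above T₁ (inj₂ u) (inj₂ v)))

  inF : Fin q → Fin q → Bool
  inF u v = inY v ∧ (above T₁ (inj₂ u) (inj₂ v) ∧ above T₂ (inj₂ u) (inj₂ v))

  -- The term (1/2) Σ_u Σ_{v ∈ E_u} (1+x_u)(1-x_v) is computed as
  -- ⌊ S / 2 ⌋ where S = Σ_u Σ_{v ∈ E_u} (1+x_u)(1-x_v); S is always even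
  -- (E is symmetric), so this is exactly the paper's value.
  f : Pt → ℕ
  f x =
      invσ
    + sumF q (λ u → if inY u then 0 else cardA u)
    + sumY (λ u → cardB u + 2 * cardC u * coord x u + cardD u * (1 ∸ coord x u))
    + sumY (λ u → sumF q (λ v → if inE u v
                                  then (1 + coord x u) * (1 ∸ coord x v) else 0)) / 2
    + 2 * sumY (λ u → sumF q (λ v → if inF u v
                                      then coord x u * (1 ∸ coord x v) else 0))

-- Every minimiser of f has the property. Write f as a constant plus Σ_a ℓ_a(x_a) plus
-- ½ Σ_{a,b} φ_ab(x_a, x_b), and suppose a minimiser x has x_u = 1 and x_v = 0 for some v ∈ F_u,
-- so that u lies above v in both handles; let y be x with these two values swapped. The
-- one-variable terms do not increase, since C_v ⊆ C_u and D_u ⊆ D_v (the handles are linear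
-- orders); the terms pairing u or v with a third vertex w do not increase (a finite check over
-- the position of w relative to u and v in each handle); and the F-term 2 x_u (1 - x_v) of the
-- pair itself drops from 2 to 0. Hence f(y) < f(x). A minimiser exists since {0,1}^Y is finite.
module Submission where

open import Defs
open import Data.Nat using (ℕ; _≤_)
open import Data.Bool using (T)
open import Data.Fin using (Fin)
open import Data.Product using (Σ; _×_)

open import Algebra.Properties.CommutativeSemigroup using (x∙yz≈y∙xz)
open import Data.Bool using (Bool; true; false; if_then_else_; _∧_; _∨_)
open import Data.Bool.Properties using (∧-conicalˡ; ∧-conicalʳ; ∨-zeroʳ; T-≡)
open import Data.Fin using (zero; suc)
open import Data.Fin.Properties using (_≟_)
import Data.List as List
open import Data.List using (List; []; _∷_)
open import Data.List.Properties using (map-tabulate)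
open import Data.List.Relation.Unary.All using (All; _∷_)
open import Data.List.Relation.Unary.AllPairs using (_∷_)
open import Data.List.Relation.Unary.Unique.Propositional using (Unique)
open import Data.Nat using (zero; suc; _+_; _*_; _∸_; _/_; z≤n)
open import Data.Nat.DivMod using (m*n/n≡m; +-distrib-/-∣ʳ; /-monoˡ-≤)
open import Data.Nat.Divisibility using (divides)
import Data.Nat.ListAction as ListAction
open import Data.Nat.Properties
  using ( +-*-semiring; +-commutativeSemigroup; +-assoc; +-comm; +-suc
        ; ≤ᵇ⇒≤; ≤-refl; ≤-reflexive; ≤-trans; ≤-total; ≤⇒≯
        ; +-mono-≤; +-monoʳ-≤; *-monoʳ-≤; module ≤-Reasoning)
open import Data.Nat.Tactic.RingSolver using (solve-∀)
open import Algebra.Properties.Semiring.Sum +-*-semiring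
  using (sum; sum-syntax; sum-cong-≗; sum-replicate-zero; ∑-distrib-+; *-distribˡ-sum)
open import Data.Product using (_,_)
open import Data.Sum using (_⊎_; inj₁; inj₂)
open import Data.Sum.Properties using (inj₂-injective)
open import Data.Unit using (tt)
open import Data.Vec using (Vec; []; _∷_; lookup; tabulate)
open import Data.Vec.Properties using (lookup∘tabulate)
open import Function using (_∘_; id; Equivalence)
open import Relation.Binary.PropositionalEquality
open import Relation.Nullary using (¬_; yes; no; does; contradiction)
open import Relation.Nullary.Decidable using (dec-true; dec-false)

sumF≡sum : ∀ n (g : Fin n → ℕ) → sumF n g ≡ sum g
sumF≡sum n g = trans (cong ListAction.sum (map-tabulate id g)) (sum-tabulate n g)
  where
  sum-tabulate : ∀ n (g : Fin n → ℕ) → ListAction.sum (List.tabulate g) ≡ sum g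
  sum-tabulate zero    g = refl
  sum-tabulate (suc n) g = cong (g zero +_) (sum-tabulate n (g ∘ suc))

sum-mono : ∀ {n} {g h : Fin n → ℕ} → (∀ i → g i ≤ h i) → sum g ≤ sum h
sum-mono {zero}  g≤h = z≤n
sum-mono {suc n} g≤h = +-mono-≤ (g≤h zero) (sum-mono (g≤h ∘ suc))

if-sum : ∀ {n} β (g : Fin n → ℕ) → (if β then sum g else 0) ≡ sum (λ i → if β then g i else 0)
if-sum     true  g = refl
if-sum {n} false g = sym (sum-replicate-zero n)

erase : ∀ {n} → Fin n → (Fin n → ℕ) → Fin n → ℕ
erase u g i = if does (i ≟ u) then 0 else g i

erase-other : ∀ {n} {u i : Fin n} g → i ≢ u → erase u g i ≡ g i
erase-other {u = u} {i} g i≢u = cong (if_then 0 else g i) (dec-false (i ≟ u) i≢u)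

sum-erase : ∀ {n} (u : Fin n) g → sum g ≡ g u + sum (erase u g)
sum-erase zero    g = refl
sum-erase (suc u) g = begin
  g zero + sum (g ∘ suc)                          ≡⟨ cong (g zero +_) (sum-erase u (g ∘ suc)) ⟩
  g zero + (g (suc u) + sum (erase u (g ∘ suc)))  ≡⟨ x∙yz≈y∙xz +-commutativeSemigroup (g zero) (g (suc u)) _ ⟩
  g (suc u) + sum (erase (suc u) g)               ∎
  where open ≡-Reasoning

module PairSplit {n} (u v : Fin n) (v≢u : v ≢ u) where

  outside : (Fin n → ℕ) → Fin n → ℕ
  outside g = erase v (erase u g)

  sum-pair : ∀ g → sum g ≡ g u + g v + sum (outside g)
  sum-pair g = begin
    sum g                                  ≡⟨ sum-erase u g ⟩
    g u + sum (erase u g)                  ≡⟨ cong (g u +_) (sum-erase v (erase u g)) ⟩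
    g u + (erase u g v + sum (outside g))  ≡⟨ cong (λ a → g u + (a + sum (outside g))) (erase-other g v≢u) ⟩
    g u + (g v + sum (outside g))          ≡⟨ +-assoc (g u) (g v) _ ⟨
    g u + g v + sum (outside g)            ∎
    where open ≡-Reasoning

  outside-+ : ∀ g h i → outside (λ j → g j + h j) i ≡ outside g i + outside h i
  outside-+ g h i with i ≟ v
  ... | yes _ = refl
  ... | no _ with i ≟ u
  ... | yes _ = refl
  ... | no _  = refl

  outside-cong : ∀ {g h} → (∀ i → i ≢ u → i ≢ v → g i ≡ h i) → ∀ i → outside g i ≡ outside h i
  outside-cong g≡h i with i ≟ v
  ... | yes _ = refl
  ... | no i≢v with i ≟ u
  ... | yes _   = refl
  ... | no i≢u  = g≡h i i≢u i≢v

  outside-mono : ∀ {g h} → (∀ i → i ≢ u → i ≢ v → g i ≤ h i) → ∀ i → outside g i ≤ outside h i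
  outside-mono g≤h i with i ≟ v
  ... | yes _ = z≤n
  ... | no i≢v with i ≟ u
  ... | yes _   = z≤n
  ... | no i≢u  = g≤h i i≢u i≢v

  corner : (Fin n → Fin n → ℕ) → ℕ
  corner t = t u u + t u v + (t v u + t v v)

  cross : (Fin n → Fin n → ℕ) → Fin n → ℕ
  cross t w = t u w + t v w + (t w u + t w v)

  rest : (Fin n → Fin n → ℕ) → ℕ
  rest t = sum (outside (λ a → sum (outside (t a))))

  double-sum-pair : ∀ t → ∑[ a < n ] ∑[ b < n ] t a b ≡ corner t + sum (outside (cross t)) + rest t
  double-sum-pair t = begin
    sum (λ a → sum (t a))                               ≡⟨ sum-cong-≗ (λ a → sum-pair (t a)) ⟩
    sum (λ a → P a + Q a)                               ≡⟨ ∑-distrib-+ P Q ⟩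
    sum P + sum Q                                       ≡⟨ cong₂ _+_ (sum-pair P) (sum-pair Q) ⟩
    P u + P v + sum (outside P) + (Q u + Q v + rest t)  ≡⟨ regroup (P u) (P v) (sum (outside P)) (Q u) (Q v) (rest t) ⟩
    corner t + (Q u + Q v + sum (outside P)) + rest t   ≡⟨ cong (λ s → corner t + s + rest t) cross-sum ⟨
    corner t + sum (outside (cross t)) + rest t         ∎
    where
    open ≡-Reasoning
    P Q : Fin n → ℕ
    P a = t a u + t a v
    Q a = sum (outside (t a))
    regroup : ∀ a b c d e r → a + b + c + (d + e + r) ≡ a + b + (d + e + c) + r
    regroup = solve-∀
    cross-sum : sum (outside (cross t)) ≡ Q u + Q v + sum (outside P)
    cross-sum = begin
      sum (outside (cross t))
        ≡⟨ sum-cong-≗ (λ w → trans (outside-+ (λ a → t u a + t v a) P w)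
                                   (cong (_+ outside P w) (outside-+ (t u) (t v) w))) ⟩
      sum (λ w → outside (t u) w + outside (t v) w + outside P w)
        ≡⟨ ∑-distrib-+ _ (outside P) ⟩
      sum (λ w → outside (t u) w + outside (t v) w) + sum (outside P)
        ≡⟨ cong (_+ sum (outside P)) (∑-distrib-+ (outside (t u)) (outside (t v))) ⟩
      Q u + Q v + sum (outside P) ∎

  double-sum-exchange : ∀ {k} t t' → corner t + k ≤ corner t' →
    (∀ w → w ≢ u → w ≢ v → cross t w ≤ cross t' w) →
    (∀ a b → a ≢ u → a ≢ v → b ≢ u → b ≢ v → t a b ≡ t' a b) →
    ∑[ a < n ] ∑[ b < n ] t a b + k ≤ ∑[ a < n ] ∑[ b < n ] t' a b
  double-sum-exchange {k} t t' corner≤ cross≤ rest≡ = begin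
    sum (λ a → sum (t a)) + k                          ≡⟨ cong (_+ k) (double-sum-pair t) ⟩
    corner t + sum (outside (cross t)) + rest t + k    ≡⟨ move-k (corner t) _ _ k ⟩
    corner t + k + sum (outside (cross t)) + rest t
      ≤⟨ +-mono-≤ (+-mono-≤ corner≤ (sum-mono (outside-mono cross≤))) (≤-reflexive rest-same) ⟩
    corner t' + sum (outside (cross t')) + rest t'     ≡⟨ double-sum-pair t' ⟨
    sum (λ a → sum (t' a))                             ∎
    where
    open ≤-Reasoning
    move-k : ∀ a b c k → a + b + c + k ≡ a + k + b + c
    move-k = solve-∀
    rest-same : rest t ≡ rest t'
    rest-same = sum-cong-≗ (outside-cong (λ a a≢u a≢v →
      sum-cong-≗ (outside-cong (λ b b≢u b≢v → rest≡ a b a≢u a≢v b≢u b≢v))))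

∧-mono : ∀ {a b c d} → (a ≡ true → c ≡ true) → (b ≡ true → d ≡ true) →
  a ∧ b ≡ true → c ∧ d ≡ true
∧-mono {true} {true} a⇒c b⇒d _ rewrite a⇒c refl | b⇒d refl = refl

∨-mono : ∀ {a b c d} → (a ≡ true → c ≡ true) → (b ≡ true → d ≡ true) →
  a ∨ b ≡ true → c ∨ d ≡ true
∨-mono {true}             a⇒c b⇒d _ rewrite a⇒c refl = refl
∨-mono {false} {true} {c} a⇒c b⇒d _ rewrite b⇒d refl = ∨-zeroʳ c

count-mono : ∀ n {g h : Fin n → Bool} → (∀ i → g i ≡ true → h i ≡ true) → count n g ≤ count n h
count-mono n {g} {h} g⇒h = begin
  count n g              ≡⟨ sumF≡sum n _ ⟩
  sum (λ i → bit (g i))  ≤⟨ sum-mono (λ i → bit-mono (g⇒h i)) ⟩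
  sum (λ i → bit (h i))  ≡⟨ sumF≡sum n _ ⟨
  count n h              ∎
  where
  open ≤-Reasoning
  bit-mono : ∀ {a b} → (a ≡ true → b ≡ true) → bit a ≤ bit b
  bit-mono {false} _   = z≤n
  bit-mono {true}  a⇒b rewrite a⇒b refl = ≤-refl

-- Indexed by (w above u, u above w, w above v, v above w) for a vertex w ∉ {u, v} of a handle
-- in which u lies above v.
data Position : Bool → Bool → Bool → Bool → Set where
  higher  : Position true  false true  false
  between : Position false true  true  false
  lower   : Position false true  false true

-- Indexed by (u above u, v above v, u above v, v above u).
data Ordered : Bool → Bool → Bool → Bool → Set where
  ordered : Ordered false false true false

module _ {p q : ℕ} where

  memᵇ-∉ : ∀ {c : V p q} L → All (c ≢_) L → memᵇ L c ≡ false
  memᵇ-∉ []      _ = refl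
  memᵇ-∉ {c} (d ∷ L) (c≢d ∷ c∉L) with d ≟V c
  ... | yes d≡c = contradiction (sym d≡c) c≢d
  ... | no _    = memᵇ-∉ L c∉L

  aboveᵇ⇒memᵇˡ : ∀ (L : List (V p q)) {a b} → aboveᵇ L a b ≡ true → memᵇ L a ≡ true
  aboveᵇ⇒memᵇˡ (c ∷ L) {a} {b} h with c ≟V a
  ... | yes _ = refl
  ... | no _ with c ≟V b
  ... | yes _ = contradiction h (λ ())
  ... | no _  = aboveᵇ⇒memᵇˡ L h

  aboveᵇ⇒memᵇʳ : ∀ (L : List (V p q)) {a b} → aboveᵇ L a b ≡ true → memᵇ L b ≡ true
  aboveᵇ⇒memᵇʳ (c ∷ L) {a} {b} h with c ≟V a | c ≟V b
  ... | yes _ | yes _ = refl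
  ... | yes _ | no _  = h
  ... | no _  | yes _ = refl
  ... | no _  | no _  = aboveᵇ⇒memᵇʳ L h

  aboveᵇ-trans : ∀ (L : List (V p q)) {a b d} →
    aboveᵇ L a b ≡ true → aboveᵇ L b d ≡ true → aboveᵇ L a d ≡ true
  aboveᵇ-trans (c ∷ L) {a} {b} {d} h₁ h₂ with c ≟V a | c ≟V b | c ≟V d
  ... | yes _ | yes _ | _     = h₂
  ... | yes _ | no _  | yes _ = contradiction h₂ (λ ())
  ... | yes _ | no _  | no _  = aboveᵇ⇒memᵇʳ L h₂
  ... | no _  | yes _ | _     = contradiction h₁ (λ ())
  ... | no _  | no _  | yes _ = contradiction h₂ (λ ())
  ... | no _  | no _  | no _  = aboveᵇ-trans L h₁ h₂

  aboveᵇ-asym : ∀ {L : List (V p q)} → Unique L → ∀ {a b} →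
    aboveᵇ L a b ≡ true → aboveᵇ L b a ≡ false
  aboveᵇ-asym {c ∷ L} (c∉L ∷ L!) {a} {b} h with c ≟V a | c ≟V b
  ... | yes refl | yes refl = contradiction (trans (sym h) (memᵇ-∉ L c∉L)) (λ ())
  ... | yes _    | no _     = refl
  ... | no _     | yes _    = contradiction h (λ ())
  ... | no _     | no _     = aboveᵇ-asym L! h

  aboveᵇ-irrefl : ∀ {L : List (V p q)} → Unique L → ∀ a → aboveᵇ L a a ≡ false
  aboveᵇ-irrefl {L} L! a with aboveᵇ L a a in a<a
  ... | false = refl
  ... | true  = trans (sym a<a) (aboveᵇ-asym L! a<a)

  aboveᵇ-total : ∀ (L : List (V p q)) {a b} → memᵇ L a ≡ true → memᵇ L b ≡ true → a ≢ b →
    aboveᵇ L a b ≡ true ⊎ aboveᵇ L b a ≡ true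
  aboveᵇ-total (c ∷ L) {a} {b} a∈L b∈L a≢b with c ≟V a | c ≟V b
  ... | yes refl | yes refl = contradiction refl a≢b
  ... | yes _    | no _     = inj₁ b∈L
  ... | no _     | yes _    = inj₂ a∈L
  ... | no _     | no _     = aboveᵇ-total L a∈L b∈L a≢b

  ordered-pair : ∀ {L : List (V p q)} → Unique L → ∀ {u v} → aboveᵇ L u v ≡ true →
    Ordered (aboveᵇ L u u) (aboveᵇ L v v) (aboveᵇ L u v) (aboveᵇ L v u)
  ordered-pair L! {u} {v} u<v
    rewrite aboveᵇ-irrefl L! u | aboveᵇ-irrefl L! v | u<v | aboveᵇ-asym L! u<v = ordered

  position : ∀ {L : List (V p q)} → Unique L → ∀ {u v w} → aboveᵇ L u v ≡ true →
    memᵇ L w ≡ true → w ≢ u → w ≢ v →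
    Position (aboveᵇ L w u) (aboveᵇ L u w) (aboveᵇ L w v) (aboveᵇ L v w)
  position {L} L! {u} {v} {w} u<v w∈L w≢u w≢v
    with aboveᵇ-total L w∈L (aboveᵇ⇒memᵇˡ L u<v) w≢u
  ... | inj₁ w<u
    rewrite w<u | aboveᵇ-asym L! w<u | aboveᵇ-trans L w<u u<v
          | aboveᵇ-asym L! (aboveᵇ-trans L w<u u<v) = higher
  ... | inj₂ u<w with aboveᵇ-total L w∈L (aboveᵇ⇒memᵇʳ L u<v) w≢v
  ... | inj₁ w<v rewrite u<w | w<v | aboveᵇ-asym L! u<w | aboveᵇ-asym L! w<v = between
  ... | inj₂ v<w rewrite u<w | v<w | aboveᵇ-asym L! v<w | aboveᵇ-asym L! u<w = lower

-- Indexed by (u ∈ Y, v ∈ Y, x_u, x_v, y_u, y_v) for the swap of a violating pair.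
data Exchange : Bool → Bool → ℕ → ℕ → ℕ → ℕ → Set where
  exchange : Exchange true true 1 0 0 1

exchange-of : ∀ {yu yv cu cv du dv} → yu ≡ true → yv ≡ true →
  cu ≡ 1 → cv ≡ 0 → du ≡ 0 → dv ≡ 1 → Exchange yu yv cu cv du dv
exchange-of refl refl refl refl refl refl = exchange

-- Twice the E- and F-summands of f for the ordered pair (a, b), so that
-- f = constant + Σ linear + (Σ pairTerm) / 2, exactly even for the floor division (half-+).
pairTerm : (ya b∈E b∈F : Bool) (ca cb : ℕ) → ℕ
pairTerm ya b∈E b∈F ca cb = (if ya then (if b∈E then (1 + ca) * (1 ∸ cb) else 0) else 0)
                          + 4 * (if ya then (if b∈F then ca * (1 ∸ cb) else 0) else 0)

-- ab₁ (ba₁): a above b (b above a) in the handle of T₁; likewise ab₂, ba₂ for T₂.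
orderTerm : (ya yb ab₁ ba₁ ab₂ ba₂ : Bool) (ca cb : ℕ) → ℕ
orderTerm ya yb ab₁ ba₁ ab₂ ba₂ =
  pairTerm ya (yb ∧ ((ba₁ ∧ ab₂) ∨ (ba₂ ∧ ab₁))) (yb ∧ (ab₁ ∧ ab₂))

linearTerm : (y : Bool) (B C D c : ℕ) → ℕ
linearTerm y B C D c = if y then B + 2 * C * c + D * (1 ∸ c) else 0

corner-exchange : ∀ {yu yv cu cv du dv uu₁ vv₁ uv₁ vu₁ uu₂ vv₂ uv₂ vu₂} →
  Exchange yu yv cu cv du dv → Ordered uu₁ vv₁ uv₁ vu₁ → Ordered uu₂ vv₂ uv₂ vu₂ →
  orderTerm yu yu uu₁ uu₁ uu₂ uu₂ du du + orderTerm yu yv uv₁ vu₁ uv₂ vu₂ du dv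
    + (orderTerm yv yu vu₁ uv₁ vu₂ uv₂ dv du + orderTerm yv yv vv₁ vv₁ vv₂ vv₂ dv dv) + 2
  ≤ orderTerm yu yu uu₁ uu₁ uu₂ uu₂ cu cu + orderTerm yu yv uv₁ vu₁ uv₂ vu₂ cu cv
    + (orderTerm yv yu vu₁ uv₁ vu₂ uv₂ cv cu + orderTerm yv yv vv₁ vv₁ vv₂ vv₂ cv cv)
corner-exchange exchange ordered ordered = ≤ᵇ⇒≤ _ _ _

cross-exchange : ∀ {yu yv cu cv du dv α₁ β₁ γ₁ δ₁ α₂ β₂ γ₂ δ₂} yw {cw} →
  Exchange yu yv cu cv du dv →
  (yw ≡ true → Position α₁ β₁ γ₁ δ₁ × Position α₂ β₂ γ₂ δ₂ × (cw ≡ 0 ⊎ cw ≡ 1)) →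
  orderTerm yu yw β₁ α₁ β₂ α₂ du cw + orderTerm yv yw δ₁ γ₁ δ₂ γ₂ dv cw
    + (orderTerm yw yu α₁ β₁ α₂ β₂ cw du + orderTerm yw yv γ₁ δ₁ γ₂ δ₂ cw dv)
  ≤ orderTerm yu yw β₁ α₁ β₂ α₂ cu cw + orderTerm yv yw δ₁ γ₁ δ₂ γ₂ cv cw
    + (orderTerm yw yu α₁ β₁ α₂ β₂ cw cu + orderTerm yw yv γ₁ δ₁ γ₂ δ₂ cw cv)
cross-exchange false exchange _ = z≤n
cross-exchange true exchange w∈Y with w∈Y refl
... | higher  , higher  , inj₁ refl = ≤ᵇ⇒≤ _ _ _
... | higher  , higher  , inj₂ refl = ≤ᵇ⇒≤ _ _ _
... | higher  , between , inj₁ refl = ≤ᵇ⇒≤ _ _ _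
... | higher  , between , inj₂ refl = ≤ᵇ⇒≤ _ _ _
... | higher  , lower   , inj₁ refl = ≤ᵇ⇒≤ _ _ _
... | higher  , lower   , inj₂ refl = ≤ᵇ⇒≤ _ _ _
... | between , higher  , inj₁ refl = ≤ᵇ⇒≤ _ _ _
... | between , higher  , inj₂ refl = ≤ᵇ⇒≤ _ _ _
... | between , between , inj₁ refl = ≤ᵇ⇒≤ _ _ _
... | between , between , inj₂ refl = ≤ᵇ⇒≤ _ _ _
... | between , lower   , inj₁ refl = ≤ᵇ⇒≤ _ _ _
... | between , lower   , inj₂ refl = ≤ᵇ⇒≤ _ _ _
... | lower   , higher  , inj₁ refl = ≤ᵇ⇒≤ _ _ _
... | lower   , higher  , inj₂ refl = ≤ᵇ⇒≤ _ _ _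
... | lower   , between , inj₁ refl = ≤ᵇ⇒≤ _ _ _
... | lower   , between , inj₂ refl = ≤ᵇ⇒≤ _ _ _
... | lower   , lower   , inj₁ refl = ≤ᵇ⇒≤ _ _ _
... | lower   , lower   , inj₂ refl = ≤ᵇ⇒≤ _ _ _

linear-exchange : ∀ {yu yv cu cv du dv} Bu Cu Du Bv Cv Dv → Exchange yu yv cu cv du dv →
  Du ≤ Dv → Cv ≤ Cu →
  linearTerm yu Bu Cu Du du + linearTerm yv Bv Cv Dv dv ≤ linearTerm yu Bu Cu Du cu + linearTerm yv Bv Cv Dv cv
linear-exchange Bu Cu Du Bv Cv Dv exchange Du≤Dv Cv≤Cu = begin
  Bu + 2 * Cu * 0 + Du * 1 + (Bv + 2 * Cv * 1 + Dv * 0) ≡⟨ before Bu Cu Du Bv Cv Dv ⟩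
  Bu + Bv + (Du + 2 * Cv)                               ≤⟨ +-monoʳ-≤ (Bu + Bv) (+-mono-≤ Du≤Dv (*-monoʳ-≤ 2 Cv≤Cu)) ⟩
  Bu + Bv + (Dv + 2 * Cu)                               ≡⟨ after Bu Cu Du Bv Cv Dv ⟩
  Bu + 2 * Cu * 1 + Du * 0 + (Bv + 2 * Cv * 0 + Dv * 1) ∎
  where
  open ≤-Reasoning
  before : ∀ Bu Cu Du Bv Cv Dv → Bu + 2 * Cu * 0 + Du * 1 + (Bv + 2 * Cv * 1 + Dv * 0) ≡ Bu + Bv + (Du + 2 * Cv)
  before = solve-∀
  after : ∀ Bu Cu Du Bv Cv Dv → Bu + Bv + (Dv + 2 * Cu) ≡ Bu + 2 * Cu * 1 + Du * 0 + (Bv + 2 * Cv * 0 + Dv * 1)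
  after = solve-∀

half-+ : ∀ m n → m / 2 + 2 * n ≡ (m + 4 * n) / 2
half-+ m n = begin
  m / 2 + 2 * n              ≡⟨ cong (m / 2 +_) (m*n/n≡m (2 * n) 2) ⟨
  m / 2 + 2 * n * 2 / 2      ≡⟨ +-distrib-/-∣ʳ m (divides (2 * n) refl) ⟨
  (m + 2 * n * 2) / 2        ≡⟨ cong (λ k → (m + k) / 2) (four n) ⟩
  (m + 4 * n) / 2            ∎
  where
  open ≡-Reasoning
  four : ∀ n → 2 * n * 2 ≡ 4 * n
  four = solve-∀

halve-strict : ∀ {m n} → m + 2 ≤ n → suc (m / 2) ≤ n / 2
halve-strict {m} {n} m+2≤n = begin
  suc (m / 2)        ≡⟨ +-comm 1 (m / 2) ⟩
  m / 2 + 1          ≡⟨ +-distrib-/-∣ʳ m (divides 1 refl) ⟨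
  (m + 2) / 2        ≤⟨ /-monoˡ-≤ 2 m+2≤n ⟩
  n / 2              ∎
  where open ≤-Reasoning

cube-argmin : ∀ n (F : Vec Bool n → ℕ) → Σ (Vec Bool n) λ s → ∀ t → F s ≤ F t
cube-argmin zero    F = [] , λ { [] → ≤-refl }
cube-argmin (suc n) F
  with cube-argmin n (F ∘ (false ∷_)) | cube-argmin n (F ∘ (true ∷_))
... | s₀ , min₀ | s₁ , min₁ with ≤-total (F (false ∷ s₀)) (F (true ∷ s₁))
... | inj₁ F₀≤F₁ = false ∷ s₀ , λ { (false ∷ t) → min₀ t ; (true ∷ t) → ≤-trans F₀≤F₁ (min₁ t) }
... | inj₂ F₁≤F₀ = true ∷ s₁ , λ { (false ∷ t) → ≤-trans F₁≤F₀ (min₀ t) ; (true ∷ t) → min₁ t }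

orFalse : (b : Bool) → (T b → Bool) → Bool
orFalse true  g = g tt
orFalse false _ = false

module Objective {p q : ℕ} (T₁ T₂ : Broom p q) where

  term : Fin q → Fin q → ℕ → ℕ → ℕ
  term a b = orderTerm (inY T₁ T₂ a) (inY T₁ T₂ b)
    (above T₁ (inj₂ a) (inj₂ b)) (above T₁ (inj₂ b) (inj₂ a))
    (above T₂ (inj₂ a) (inj₂ b)) (above T₂ (inj₂ b) (inj₂ a))

  pairSum : (Fin q → ℕ) → ℕ
  pairSum c = ∑[ a < q ] ∑[ b < q ] term a b (c a) (c b)

  linear : Fin q → ℕ → ℕ
  linear a = linearTerm (inY T₁ T₂ a) (cardB T₁ T₂ a) (cardC T₁ T₂ a) (cardD T₁ T₂ a)

  constant : ℕ
  constant = invσ T₁ T₂ + sumF q (λ u → if inY T₁ T₂ u then 0 else cardA T₁ T₂ u)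

  fᶜ : (Fin q → ℕ) → ℕ
  fᶜ c = constant + ∑[ a < q ] linear a (c a) + pairSum c / 2

  fᶜ-cong : ∀ {c c'} → (∀ a → c a ≡ c' a) → fᶜ c ≡ fᶜ c'
  fᶜ-cong c≗c' = cong₂ (λ l s → constant + l + s / 2)
    (sum-cong-≗ (λ a → cong (linear a) (c≗c' a)))
    (sum-cong-≗ (λ a → sum-cong-≗ (λ b → cong₂ (term a b) (c≗c' a) (c≗c' b))))

  f≡fᶜ : ∀ x → f T₁ T₂ x ≡ fᶜ (coord T₁ T₂ x)
  f≡fᶜ x = begin
    f T₁ T₂ x                        ≡⟨ +-assoc (constant + L) (S / 2) (2 * G) ⟩
    constant + L + (S / 2 + 2 * G)   ≡⟨ cong₂ (λ l s → constant + l + s) (sumF≡sum q _) (half-+ S G) ⟩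
    constant + L′ + (S + 4 * G) / 2  ≡⟨ cong (λ s → constant + L′ + s / 2) S+4G≡pairSum ⟩
    fᶜ c                             ∎
    where
    open ≡-Reasoning
    c = coord T₁ T₂ x
    L′ = ∑[ a < q ] linear a (c a)
    L = sumY T₁ T₂ (λ u → cardB T₁ T₂ u + 2 * cardC T₁ T₂ u * c u + cardD T₁ T₂ u * (1 ∸ c u))
    E F : Fin q → Fin q → ℕ
    E a b = if inE T₁ T₂ a b then (1 + c a) * (1 ∸ c b) else 0
    F a b = if inF T₁ T₂ a b then c a * (1 ∸ c b) else 0
    S = sumY T₁ T₂ (λ a → sumF q (E a))
    G = sumY T₁ T₂ (λ a → sumF q (F a))
    onY : (Fin q → Fin q → ℕ) → Fin q → Fin q → ℕ
    onY e a b = if inY T₁ T₂ a then e a b else 0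
    sumY≡ : ∀ e → sumY T₁ T₂ (λ a → sumF q (e a)) ≡ ∑[ a < q ] ∑[ b < q ] onY e a b
    sumY≡ e = trans (sumF≡sum q _) (sum-cong-≗ (λ a →
      trans (cong (λ s → if inY T₁ T₂ a then s else 0) (sumF≡sum q (e a))) (if-sum (inY T₁ T₂ a) (e a))))
    S+4G≡pairSum : S + 4 * G ≡ pairSum c
    S+4G≡pairSum = begin
      S + 4 * G  ≡⟨ cong₂ (λ s g → s + 4 * g) (sumY≡ E) (sumY≡ F) ⟩
      sum (λ a → sum (onY E a)) + 4 * sum (λ a → sum (onY F a))
        ≡⟨ cong (sum (λ a → sum (onY E a)) +_) (trans (*-distribˡ-sum 4 (λ a → sum (onY F a)))
                                                      (sum-cong-≗ (λ a → *-distribˡ-sum 4 (onY F a)))) ⟩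
      sum (λ a → sum (onY E a)) + sum (λ a → sum (λ b → 4 * onY F a b))
        ≡⟨ ∑-distrib-+ (λ a → sum (onY E a)) (λ a → sum (λ b → 4 * onY F a b)) ⟨
      sum (λ a → sum (onY E a) + sum (λ b → 4 * onY F a b))
        ≡⟨ sum-cong-≗ (λ a → ∑-distrib-+ (onY E a) _) ⟨
      pairSum c ∎

  strict-decrease : ∀ {c c'} → ∑[ a < q ] linear a (c a) ≤ ∑[ a < q ] linear a (c' a) →
    pairSum c + 2 ≤ pairSum c' → suc (fᶜ c) ≤ fᶜ c'
  strict-decrease {c} {c'} lin≤ pair< = begin
    suc (constant + ∑[ a < q ] linear a (c a) + pairSum c / 2)
      ≡⟨ +-suc _ _ ⟨
    constant + ∑[ a < q ] linear a (c a) + suc (pairSum c / 2)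
      ≤⟨ +-mono-≤ (+-monoʳ-≤ constant lin≤) (halve-strict pair<) ⟩
    fᶜ c' ∎
    where open ≤-Reasoning

  update : Pt T₁ T₂ → Fin q → Bool → Pt T₁ T₂
  update x w b w' h = if does (w' ≟ w) then b else x w' h

  coord-cong : ∀ x x' w → (∀ h → x w h ≡ x' w h) → coord T₁ T₂ x w ≡ coord T₁ T₂ x' w
  coord-cong x x' w x≡x' with inY T₁ T₂ w | x w | x' w
  ... | true  | _ | _ = cong bit (x≡x' tt)
  ... | false | _ | _ = refl

  coord-const : ∀ x w b → inY T₁ T₂ w ≡ true → (∀ h → x w h ≡ b) → coord T₁ T₂ x w ≡ bit b
  coord-const x w b w∈Y x≡b with inY T₁ T₂ w | x w
  ... | true | _ = cong bit (x≡b tt)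

  coord-bit : ∀ x w → inY T₁ T₂ w ≡ true → coord T₁ T₂ x w ≡ 0 ⊎ coord T₁ T₂ x w ≡ 1
  coord-bit x w w∈Y with inY T₁ T₂ w | x w
  ... | true | g with g tt
  ...   | false = inj₁ refl
  ...   | true  = inj₂ refl

  coord-update-same : ∀ x w b → inY T₁ T₂ w ≡ true → coord T₁ T₂ (update x w b) w ≡ bit b
  coord-update-same x w b w∈Y = coord-const (update x w b) w b w∈Y
    (λ h → cong (if_then b else x w h) (dec-true (w ≟ w) refl))

  coord-update-other : ∀ x {w w'} b → w' ≢ w → coord T₁ T₂ (update x w b) w' ≡ coord T₁ T₂ x w'
  coord-update-other x {w} {w'} b w'≢w = coord-cong (update x w b) x w'
    (λ h → cong (if_then b else x w' h) (dec-false (w' ≟ w) w'≢w))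

  module Swap (x : Pt T₁ T₂) {u v : Fin q} (u∈Y : inY T₁ T₂ u ≡ true) (v∈F : inF T₁ T₂ u v ≡ true)
              (xu≡1 : coord T₁ T₂ x u ≡ 1) (xv≡0 : coord T₁ T₂ x v ≡ 0) where

    v∈Y : inY T₁ T₂ v ≡ true
    v∈Y = ∧-conicalˡ (inY T₁ T₂ v) _ v∈F

    u<v₁ : above T₁ (inj₂ u) (inj₂ v) ≡ true
    u<v₁ = ∧-conicalˡ _ (above T₂ (inj₂ u) (inj₂ v)) (∧-conicalʳ (inY T₁ T₂ v) _ v∈F)

    u<v₂ : above T₂ (inj₂ u) (inj₂ v) ≡ true
    u<v₂ = ∧-conicalʳ (above T₁ (inj₂ u) (inj₂ v)) _ (∧-conicalʳ (inY T₁ T₂ v) _ v∈F)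

    v≢u : v ≢ u
    v≢u refl = contradiction (trans (sym (aboveᵇ-irrefl (unique T₁) (inj₂ u))) u<v₁) λ ()

    y : Pt T₁ T₂
    y = update (update x u false) v true

    yu≡0 : coord T₁ T₂ y u ≡ 0
    yu≡0 = trans (coord-update-other (update x u false) true (v≢u ∘ sym)) (coord-update-same x u false u∈Y)

    yv≡1 : coord T₁ T₂ y v ≡ 1
    yv≡1 = coord-update-same (update x u false) v true v∈Y

    y≡x : ∀ w → w ≢ u → w ≢ v → coord T₁ T₂ y w ≡ coord T₁ T₂ x w
    y≡x w w≢u w≢v = trans (coord-update-other (update x u false) true w≢v) (coord-update-other x false w≢u)

    exch : Exchange (inY T₁ T₂ u) (inY T₁ T₂ v)
                    (coord T₁ T₂ x u) (coord T₁ T₂ x v) (coord T₁ T₂ y u) (coord T₁ T₂ y v)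
    exch = exchange-of u∈Y v∈Y xu≡1 xv≡0 yu≡0 yv≡1

    open PairSplit u v v≢u

    linear-decrease : ∑[ a < q ] linear a (coord T₁ T₂ y a) ≤ ∑[ a < q ] linear a (coord T₁ T₂ x a)
    linear-decrease = begin
      sum (ℓ y)                            ≡⟨ sum-pair (ℓ y) ⟩
      ℓ y u + ℓ y v + sum (outside (ℓ y))  ≤⟨ +-mono-≤ (linear-exchange _ _ _ _ _ _ exch D≤ C≤) (≤-reflexive rest≡) ⟩
      ℓ x u + ℓ x v + sum (outside (ℓ x))  ≡⟨ sum-pair (ℓ x) ⟨
      sum (ℓ x)                            ∎
      where
      open ≤-Reasoning
      ℓ : Pt T₁ T₂ → Fin q → ℕ
      ℓ z a = linear a (coord T₁ T₂ z a)
      rest≡ : sum (outside (ℓ y)) ≡ sum (outside (ℓ x))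
      rest≡ = sum-cong-≗ (outside-cong (λ a a≢u a≢v → cong (linear a) (y≡x a a≢u a≢v)))
      C≤ : cardC T₁ T₂ v ≤ cardC T₁ T₂ u
      C≤ = count-mono p (λ a → ∧-mono (aboveᵇ-trans (handle T₁) u<v₁) (aboveᵇ-trans (handle T₂) u<v₂))
      D≤ : cardD T₁ T₂ u ≤ cardD T₁ T₂ v
      D≤ = count-mono q (λ w → ∧-mono id (∨-mono (λ w<u → aboveᵇ-trans (handle T₁) w<u u<v₁)
                                                 (λ w<u → aboveᵇ-trans (handle T₂) w<u u<v₂)))

    pair-decrease : pairSum (coord T₁ T₂ y) + 2 ≤ pairSum (coord T₁ T₂ x)
    pair-decrease = double-sum-exchange (at y) (at x)
      (corner-exchange exch (ordered-pair (unique T₁) u<v₁) (ordered-pair (unique T₂) u<v₂))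
      cross≤
      (λ a b a≢u a≢v b≢u b≢v → cong₂ (term a b) (y≡x a a≢u a≢v) (y≡x b b≢u b≢v))
      where
      at : Pt T₁ T₂ → Fin q → Fin q → ℕ
      at z a b = term a b (coord T₁ T₂ z a) (coord T₁ T₂ z b)
      inj₂-≢ : ∀ {a b : Fin q} → a ≢ b → inj₂ {A = Fin p} a ≢ inj₂ b
      inj₂-≢ a≢b = a≢b ∘ inj₂-injective
      cross≤ : ∀ w → w ≢ u → w ≢ v → cross (at y) w ≤ cross (at x) w
      cross≤ w w≢u w≢v = begin
        cross (at y) w  ≡⟨ cong crossAt (y≡x w w≢u w≢v) ⟩
        crossAt (coord T₁ T₂ x w)
          ≤⟨ cross-exchange (inY T₁ T₂ w) exch (λ w∈Y →
               position (unique T₁) u<v₁ (∧-conicalˡ _ _ w∈Y) (inj₂-≢ w≢u) (inj₂-≢ w≢v) ,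
               position (unique T₂) u<v₂ (∧-conicalʳ _ _ w∈Y) (inj₂-≢ w≢u) (inj₂-≢ w≢v) ,
               coord-bit x w w∈Y) ⟩
        cross (at x) w  ∎
        where
        open ≤-Reasoning
        yu = coord T₁ T₂ y u
        yv = coord T₁ T₂ y v
        crossAt : ℕ → ℕ
        crossAt c = term u w yu c + term v w yv c + (term w u c yu + term w v c yv)

    not-minimal : ¬ (∀ z → f T₁ T₂ x ≤ f T₁ T₂ z)
    not-minimal minimal = ≤⇒≯ (minimal y)
      (subst₂ (λ m n → suc m ≤ n) (sym (f≡fᶜ y)) (sym (f≡fᶜ x)) (strict-decrease linear-decrease pair-decrease))

  minimiser-monotone : ∀ x → (∀ y → f T₁ T₂ x ≤ f T₁ T₂ y) →
    ∀ u → T (inY T₁ T₂ u) → ∀ v → T (inF T₁ T₂ u v) → coord T₁ T₂ x u ≤ coord T₁ T₂ x v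
  minimiser-monotone x minimal u u∈Y v v∈F = monotone (Equivalence.to T-≡ u∈Y) (Equivalence.to T-≡ v∈F)
    where
    monotone : inY T₁ T₂ u ≡ true → inF T₁ T₂ u v ≡ true → coord T₁ T₂ x u ≤ coord T₁ T₂ x v
    monotone u∈Y v∈F with coord-bit x u u∈Y | coord-bit x v (∧-conicalˡ (inY T₁ T₂ v) _ v∈F)
    ... | inj₁ xu≡0 | _         rewrite xu≡0 = z≤n
    ... | inj₂ xu≡1 | inj₂ xv≡1 rewrite xu≡1 | xv≡1 = ≤-refl
    ... | inj₂ xu≡1 | inj₁ xv≡0 = contradiction minimal (Swap.not-minimal x u∈Y v∈F xu≡1 xv≡0)

  fromVec : Vec Bool q → Pt T₁ T₂
  fromVec s w _ = lookup s w

  toVec : Pt T₁ T₂ → Vec Bool q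
  toVec x = tabulate (λ w → orFalse (inY T₁ T₂ w) (x w))

  f-fromVec-toVec : ∀ x → f T₁ T₂ (fromVec (toVec x)) ≡ f T₁ T₂ x
  f-fromVec-toVec x = begin
    f T₁ T₂ (fromVec (toVec x))           ≡⟨ f≡fᶜ _ ⟩
    fᶜ (coord T₁ T₂ (fromVec (toVec x)))  ≡⟨ fᶜ-cong (λ w → coord-cong (fromVec (toVec x)) x w (read-back w)) ⟩
    fᶜ (coord T₁ T₂ x)                    ≡⟨ f≡fᶜ x ⟨
    f T₁ T₂ x                             ∎
    where
    open ≡-Reasoning
    orFalse-T : ∀ b (g : T b → Bool) h → orFalse b g ≡ g h
    orFalse-T true g _ = refl
    read-back : ∀ w h → fromVec (toVec x) w h ≡ x w h
    read-back w h = trans (lookup∘tabulate (λ w′ → orFalse (inY T₁ T₂ w′) (x w′)) w) (orFalse-T _ (x w) h)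

  minimiser : Σ (Pt T₁ T₂) λ x → ∀ y → f T₁ T₂ x ≤ f T₁ T₂ y
  minimiser with cube-argmin q (f T₁ T₂ ∘ fromVec)
  ... | s , minimal = fromVec s , λ y → subst (f T₁ T₂ (fromVec s) ≤_) (f-fromVec-toVec y) (minimal (toVec y))

-- The argument never uses p ≥ 1.
lemma4p3 : {p q : ℕ} → 1 ≤ p → (T₁ T₂ : Broom p q) →
    Σ (Pt T₁ T₂) (λ x →
    ((y : Pt T₁ T₂) → f T₁ T₂ x ≤ f T₁ T₂ y) ×
    ((u : Fin q) → T (inY T₁ T₂ u) → (v : Fin q) → T (inF T₁ T₂ u v) →
    coord T₁ T₂ x u ≤ coord T₁ T₂ x v))
lemma4p3 _ T₁ T₂ with Objective.minimiser T₁ T₂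
... | x , minimal = x , minimal , Objective.minimiser-monotone T₁ T₂ x minimal
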